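{- Let $X$ be a word in $\{\mathrm D,\mathrm E,\mathrm A\}^*$ and let $T$ be a condensed multi-Catalan tableau of type $X\mathrm D$. Then the boundary transition of $T$ corresponding to the PASEP transition $X\mathrm D\to X\mathrm E$ (defined below) results in a valid condensed multi-Catalan tableau of type $X\mathrm E$.
   Context: Condensed multi-Catalan tableaux. Let $W\in\{\mathrm D,\mathrm E,\mathrm A\}^n$ have $k$ letters $\mathrm D$ and $r$ letters $\mathrm A$. Starting at the north-east corner of a rectangle with $k+r$ rows and $n-k$ columns, draw the lattice path $L(W)$ by reading $W$ left to right: $\mathrm D$ gives a south step, $\mathrm E$ a west step, $\mathrm A$ a west step followed by a south step. Let $Y(W)$ be the Young diagram (rows left-justified and top-justified in the rectangle) whose south-east boundary is $L(W)$: its $i$-th row (from the top) has length equal to the number of west steps of $L(W)$ after its $i$-th south step. Each row corresponds to a south step and each column to a west step. A row is a D-row or A-row according as its south step comes from a $\mathrm D$ or an $\mathrm A$; a column is an E-column or A-column according as its west step comes from an $\mathrm E$ or an $\mathrm A$. A DE box is a box in a D-row and E-column, and similarly DA, AE, AA boxes. A condensed multi-Catalan tableau of type $W$ is a filling of the boxes of $Y(W)$, each box being empty or containing $\alpha$ or $\beta$, such that: every box having a $\beta$ somewhere to its right in its row, or an $\alpha$ somewhere below it in its column, is empty; every other box contains $\alpha$ or $\beta$ if it is a DE box, contains $\beta$ if it is a DA box, contains $\alpha$ if it is an AE box, and is empty if it is an AA box. Boundary transition $X\mathrm D\to X\mathrm E$: if the type ends with $\mathrm D$, $T$ has at least one empty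 (length-$0$) row at its south end. Remove the bottommost such empty row; then insert a new column whose length is the maximal possible length keeping the semi-perimeter fixed, namely the number $m$ of rows remaining, with an $\alpha$ in its bottom box and all other boxes empty, placed directly to the east of every existing column of length $m$ (the rightmost position possible for that length). If $m=0$, insert a column of length $0$ containing no $\alpha$. All other rows and columns keep their contents. Finally label the boundary path by the word $X\mathrm E$. -}

module Defs where

open import Data.Nat using (ℕ; zero; suc; _<_; _<ᵇ_; _≡ᵇ_; pred)
open import Data.Bool using (Bool; true; false; if_then_else_; T)
open import Data.List using (List; []; _∷_; length)
open import Data.Maybe using (Maybe; just; nothing)
open import Data.Product using (Σ; _×_)
open import Data.Sum using (_⊎_)
open import Relation.Binary.PropositionalEquality using (_≡_)
open import Relation.Nullary using (¬_)
open import Data.Unit using (⊤)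
open import Data.Empty using (⊥)

data Letter : Set where
  D E A : Letter

data Cell : Set where
  empty α β : Cell

_!_ : List Letter → ℕ → Maybe Letter
[] ! _ = nothing
(x ∷ xs) ! zero = just x
(x ∷ xs) ! suc i = xs ! i

isSouth : Maybe Letter → Bool
isSouth (just D) = true
isSouth (just A) = true
isSouth _ = false

isWest : Maybe Letter → Bool
isWest (just E) = true
isWest (just A) = true
isWest _ = false

-- Rows of Y(W) are indexed by the positions s of D/A letters, columns by the
-- positions w of E/A letters.  Row s has length = number of west steps after
-- its south step, so the box (row s, column w) exists iff s < w.
-- A column further east = an earlier west step (smaller w);
-- a row further south = a later south step (larger s).
Box : List Letter → ℕ → ℕ → Set
Box W s w = s < w × T (isSouth (W ! s)) × T (isWest (W ! w))

-- A filling assigns a cell content to each (row, column) index pair;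
-- only the values on boxes of Y(W) are relevant.
Filling : Set
Filling = ℕ → ℕ → Cell

Blocked : List Letter → Filling → ℕ → ℕ → Set
Blocked W F s w =
  (Σ ℕ λ w' → Box W s w' × w' < w × F s w' ≡ β)
  ⊎ (Σ ℕ λ s' → Box W s' w × s < s' × F s' w ≡ α)

Required : Maybe Letter → Maybe Letter → Cell → Set
Required (just D) (just E) c = (c ≡ α) ⊎ (c ≡ β)
Required (just D) (just A) c = c ≡ β
Required (just A) (just E) c = c ≡ α
Required (just A) (just A) c = c ≡ empty
Required _ _ c = ⊤   -- never a box

IsCMCT : List Letter → Filling → Set
IsCMCT W F = ∀ s w → Box W s w →
  (Blocked W F s w → F s w ≡ empty) × (¬ Blocked W F s w → Required (W ! s) (W ! w) (F s w))

-- cut X = (position of the last D/A letter of X) + 1, or 0 if X has no D/A.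
-- Columns of maximal length m (= number of rows of X) are exactly the E's at
-- positions ≥ cut X.
cut : List Letter → ℕ
cut [] = 0
cut (x ∷ xs) with cut xs | isSouth (just x)
... | zero  | false = 0
... | zero  | true  = 1
... | suc k | _     = suc (suc k)

-- The bottom empty row (the final D, position
-- length X) is removed; a new column of length m, with α in its bottom box
-- (row cut X - 1) and otherwise empty, is inserted directly east of all existing
-- columns of length m, i.e. at word position cut X; the old columns at
-- positions ≥ cut X shift by one.
transitionDE : List Letter → Filling → Filling
transitionDE X F s w =
  if w <ᵇ cut X then F s w
  else if w ≡ᵇ cut X then (if suc s ≡ᵇ cut X then α else empty)
  else F s (pred w)

-- Rows and columns of Y(W) are indexed by positions in W, and every letter of X after
-- position cut X is an E.  Hence X E is X with an E inserted at position cut X, and the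
-- transition moves the old column at position w to punchIn (cut X) w, which preserves
-- boxes, letters, values and the relative order of columns.  Dropping the final D removes
-- a row without boxes.  So every old box keeps its blocking status and its constraint,
-- once one notes that the new column contains no β and hence blocks nothing in its
-- rows.  In the new column, every row lies above it; the bottom box (last row) has
-- nothing to its right or below it and receives α, which is allowed in a D- or A-row
-- against an E-column, and that α blocks all the boxes above it, which are empty.
module Submission where

open import Defs
open import Data.List using (List; []; _∷_; _∷ʳ_; length)
open import Data.Nat using (ℕ; zero; suc; pred; _<_; _≤_; _≡ᵇ_; z≤n; s≤s; ≢-nonZero)
open import Data.Nat.Properties
open import Data.Bool using (true; false; T; if_then_else_)
open import Data.Maybe using (just)
open import Data.Product using (_×_; _,_; proj₁; proj₂)
open import Data.Sum using (inj₁; inj₂)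
open import Data.Empty using (⊥-elim)
open import Function using (_∘_)
open import Relation.Nullary using (¬_; yes; no)
open import Relation.Binary.PropositionalEquality

punchIn : ℕ → ℕ → ℕ
punchIn zero    w       = suc w
punchIn (suc c) zero    = zero
punchIn (suc c) (suc w) = suc (punchIn c w)

punchIn-< : ∀ {c w} → w < c → punchIn c w ≡ w
punchIn-< {suc c} {zero}  _       = refl
punchIn-< {suc c} {suc w} (s≤s p) = cong suc (punchIn-< p)

punchIn-≥ : ∀ {c w} → c ≤ w → punchIn c w ≡ suc w
punchIn-≥ {zero}  z≤n     = refl
punchIn-≥ {suc c} (s≤s p) = cong suc (punchIn-≥ p)

punchIn-mono-< : ∀ c {w w'} → w < w' → punchIn c w < punchIn c w'
punchIn-mono-< zero    p                   = s≤s p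
punchIn-mono-< (suc c) {zero}  {suc w'} _  = s≤s z≤n
punchIn-mono-< (suc c) {suc w} {suc w'} (s≤s p) = s≤s (punchIn-mono-< c p)

punchIn-cancel-< : ∀ c {w w'} → punchIn c w < punchIn c w' → w < w'
punchIn-cancel-< zero    (s≤s p)                 = p
punchIn-cancel-< (suc c) {zero}  {zero}  ()
punchIn-cancel-< (suc c) {zero}  {suc w'} _      = s≤s z≤n
punchIn-cancel-< (suc c) {suc w} {zero}  ()
punchIn-cancel-< (suc c) {suc w} {suc w'} (s≤s p) = s≤s (punchIn-cancel-< c p)

punchOut : ∀ {c w : ℕ} → c ≢ w → ℕ
punchOut {zero}  {zero}  c≢w = ⊥-elim (c≢w refl)
punchOut {zero}  {suc w} _   = w
punchOut {suc c} {zero}  _   = zero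
punchOut {suc c} {suc w} c≢w = suc (punchOut (c≢w ∘ cong suc))

punchIn-punchOut : ∀ {c w : ℕ} (c≢w : c ≢ w) → punchIn c (punchOut c≢w) ≡ w
punchIn-punchOut {zero}  {zero}  c≢w = ⊥-elim (c≢w refl)
punchIn-punchOut {zero}  {suc w} _   = refl
punchIn-punchOut {suc c} {zero}  _   = refl
punchIn-punchOut {suc c} {suc w} c≢w = cong suc (punchIn-punchOut (c≢w ∘ cong suc))

insertAt : ℕ → Letter → List Letter → List Letter
insertAt zero    x ys       = x ∷ ys
insertAt (suc c) x []       = x ∷ []
insertAt (suc c) x (y ∷ ys) = y ∷ insertAt c x ys

!-insertAt : ∀ c x ys → c ≤ length ys → insertAt c x ys ! c ≡ just x
!-insertAt zero    x ys       _       = refl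
!-insertAt (suc c) x (y ∷ ys) (s≤s p) = !-insertAt c x ys p

!-insertAt-punchIn : ∀ c x ys w → c ≤ length ys → insertAt c x ys ! punchIn c w ≡ ys ! w
!-insertAt-punchIn zero    x ys       w       _       = refl
!-insertAt-punchIn (suc c) x (y ∷ ys) zero    _       = refl
!-insertAt-punchIn (suc c) x (y ∷ ys) (suc w) (s≤s p) = !-insertAt-punchIn c x ys w p

!-∷ʳ-< : ∀ ys x {i} → i < length ys → (ys ∷ʳ x) ! i ≡ ys ! i
!-∷ʳ-< (y ∷ ys) x {zero}  _       = refl
!-∷ʳ-< (y ∷ ys) x {suc i} (s≤s p) = !-∷ʳ-< ys x p

isWest⇒<length : ∀ ys {w} → T (isWest (ys ! w)) → w < length ys
isWest⇒<length (y ∷ ys) {zero}  _ = s≤s z≤n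
isWest⇒<length (y ∷ ys) {suc w} h = s≤s (isWest⇒<length ys h)

isWest-∷ʳD⇒<length : ∀ ys {w} → T (isWest ((ys ∷ʳ D) ! w)) → w < length ys
isWest-∷ʳD⇒<length []       {zero}  ()
isWest-∷ʳD⇒<length []       {suc w} ()
isWest-∷ʳD⇒<length (y ∷ ys) {zero}  _ = s≤s z≤n
isWest-∷ʳD⇒<length (y ∷ ys) {suc w} h = s≤s (isWest-∷ʳD⇒<length ys h)

cut≤length : ∀ X → cut X ≤ length X
cut≤length []       = z≤n
cut≤length (x ∷ xs) with cut xs | cut≤length xs | isSouth (just x)
... | zero  | _  | false = z≤n
... | zero  | _  | true  = s≤s z≤n
... | suc k | ih | _     = s≤s ih

isSouth⇒<cut : ∀ X {s} → T (isSouth (X ! s)) → s < cut X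
isSouth⇒<cut (D ∷ xs) {zero} _ with cut xs
... | zero  = s≤s z≤n
... | suc _ = s≤s z≤n
isSouth⇒<cut (A ∷ xs) {zero} _ with cut xs
... | zero  = s≤s z≤n
... | suc _ = s≤s z≤n
isSouth⇒<cut (x ∷ xs) {suc s} h with cut xs | isSouth⇒<cut xs h
... | suc k | ih = s≤s ih

isSouth-pred-cut : ∀ X {r} → suc r ≡ cut X → T (isSouth (X ! r))
isSouth-pred-cut (D ∷ xs) {zero} _ = _
isSouth-pred-cut (A ∷ xs) {zero} _ = _
isSouth-pred-cut (E ∷ xs) {zero} e with cut xs
isSouth-pred-cut (E ∷ xs) {zero} () | zero
isSouth-pred-cut (E ∷ xs) {zero} () | suc _
isSouth-pred-cut (x ∷ xs) {suc r} e with cut xs | isSouth-pred-cut xs {r}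
isSouth-pred-cut (D ∷ xs) {suc r} () | zero | _
isSouth-pred-cut (A ∷ xs) {suc r} () | zero | _
isSouth-pred-cut (E ∷ xs) {suc r} () | zero | _
isSouth-pred-cut (x ∷ xs) {suc r} e  | suc _ | ih = ih (suc-injective e)

insertAt-cut : ∀ X → insertAt (cut X) E X ≡ X ∷ʳ E
insertAt-cut [] = refl
insertAt-cut (x ∷ xs) with cut xs | insertAt-cut xs
insertAt-cut (D ∷ xs) | zero  | ih = cong (D ∷_) ih
insertAt-cut (A ∷ xs) | zero  | ih = cong (A ∷_) ih
insertAt-cut (E ∷ xs) | zero  | ih = cong (E ∷_) ih
insertAt-cut (x ∷ xs) | suc _ | ih = cong (x ∷_) ih

if-T : ∀ {b} {x y : Cell} → T b → (if b then x else y) ≡ x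
if-T {true} _ = refl

if-¬T : ∀ {b} {x y : Cell} → ¬ T b → (if b then x else y) ≡ y
if-¬T {true}  ¬b = ⊥-elim (¬b _)
if-¬T {false} _  = refl

transitionDE-punchIn : ∀ X F s w → transitionDE X F s (punchIn (cut X) w) ≡ F s w
transitionDE-punchIn X F s w with w <? cut X
... | yes w<c rewrite punchIn-< w<c = if-T (<⇒<ᵇ w<c)
... | no w≮c rewrite punchIn-≥ (≮⇒≥ w≮c) =
  trans (if-¬T (w≮c ∘ <⇒≤ ∘ <ᵇ⇒< (suc w) (cut X)))
        (if-¬T (w≮c ∘ ≤-reflexive ∘ ≡ᵇ⇒≡ (suc w) (cut X)))

transitionDE-new : ∀ X F s → transitionDE X F s (cut X) ≡ (if suc s ≡ᵇ cut X then α else empty)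
transitionDE-new X F s = trans (if-¬T (<-irrefl refl ∘ <ᵇ⇒< (cut X) (cut X))) (if-T (≡⇒≡ᵇ (cut X) (cut X) refl))

transitionDE-bottom : ∀ X F {s} → suc s ≡ cut X → transitionDE X F s (cut X) ≡ α
transitionDE-bottom X F {s} e = trans (transitionDE-new X F s) (if-T (≡⇒≡ᵇ (suc s) (cut X) e))

transitionDE-above : ∀ X F {s} → suc s ≢ cut X → transitionDE X F s (cut X) ≡ empty
transitionDE-above X F {s} ne = trans (transitionDE-new X F s) (if-¬T (ne ∘ ≡ᵇ⇒≡ (suc s) (cut X)))

ValidBox : List Letter → Filling → ℕ → ℕ → Set
ValidBox W F s w = (Blocked W F s w → F s w ≡ empty) × (¬ Blocked W F s w → Required (W ! s) (W ! w) (F s w))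

Required-cong : ∀ {a a' b b' x x'} → a ≡ a' → b ≡ b' → x ≡ x' → Required a b x → Required a' b' x'
Required-cong refl refl refl r = r

Required-α-E : ∀ {l} → T (isSouth l) → Required l (just E) α
Required-α-E {just D} _ = inj₁ refl
Required-α-E {just A} _ = refl

Blocked-map : ∀ {V W F s w} → (∀ {s' w'} → Box V s' w' → Box W s' w') → Blocked V F s w → Blocked W F s w
Blocked-map V⇒W (inj₁ (w' , b , w'<w , e)) = inj₁ (w' , V⇒W b , w'<w , e)
Blocked-map V⇒W (inj₂ (s' , b , s<s' , e)) = inj₂ (s' , V⇒W b , s<s' , e)

IsCMCT-transport : ∀ {V W F} →
  (V⇒W : ∀ {s w} → Box V s w → Box W s w) → (W⇒V : ∀ {s w} → Box W s w → Box V s w) →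
  (∀ {s w} → Box V s w → W ! s ≡ V ! s × W ! w ≡ V ! w) →
  IsCMCT W F → IsCMCT V F
IsCMCT-transport {V} {W} V⇒W W⇒V letters h s w b =
  proj₁ hW ∘ Blocked-map {V} {W} V⇒W ,
  λ free → Required-cong (proj₁ (letters b)) (proj₂ (letters b)) refl (proj₂ hW (free ∘ Blocked-map {W} {V} W⇒V))
  where hW = h s w (V⇒W b)

∷ʳ-letters : ∀ Y x {s w} → s < w → w < length Y → (Y ∷ʳ x) ! s ≡ Y ! s × (Y ∷ʳ x) ! w ≡ Y ! w
∷ʳ-letters Y x s<w w<∣Y∣ = !-∷ʳ-< Y x (<-trans s<w w<∣Y∣) , !-∷ʳ-< Y x w<∣Y∣

IsCMCT-∷ʳD : ∀ Y F → IsCMCT (Y ∷ʳ D) F → IsCMCT Y F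
IsCMCT-∷ʳD Y F = IsCMCT-transport {Y} {Y ∷ʳ D} keep drop (λ (s<w , _ , west) → ∷ʳ-letters Y D s<w (isWest⇒<length Y west))
  where
    drop : ∀ {s w} → Box (Y ∷ʳ D) s w → Box Y s w
    drop (s<w , south , west) with ∷ʳ-letters Y D s<w (isWest-∷ʳD⇒<length Y west)
    ... | es , ew = s<w , subst (T ∘ isSouth) es south , subst (T ∘ isWest) ew west

    keep : ∀ {s w} → Box Y s w → Box (Y ∷ʳ D) s w
    keep (s<w , south , west) with ∷ʳ-letters Y D s<w (isWest⇒<length Y west)
    ... | es , ew = s<w , subst (T ∘ isSouth) (sym es) south , subst (T ∘ isWest) (sym ew) west

module ColumnInsertion
  (Y : List Letter) (c : ℕ) (F G : Filling)
  (c≤∣Y∣ : c ≤ length Y)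
  (rows<c : ∀ {s} → T (isSouth (Y ! s)) → s < c)
  (bottom-row : ∀ {r} → suc r ≡ c → T (isSouth (Y ! r)))
  (G-punchIn : ∀ s w → G s (punchIn c w) ≡ F s w)
  (G-bottom : ∀ {s} → suc s ≡ c → G s c ≡ α)
  (G-above : ∀ {s} → suc s ≢ c → G s c ≡ empty)
  where

  Y⁺ : List Letter
  Y⁺ = insertAt c E Y

  column-letter : ∀ w → Y⁺ ! punchIn c w ≡ Y ! w
  column-letter w = !-insertAt-punchIn c E Y w c≤∣Y∣

  row-letter : ∀ {s} → s < c → Y⁺ ! s ≡ Y ! s
  row-letter {s} s<c = trans (cong (Y⁺ !_) (sym (punchIn-< s<c))) (column-letter s)

  rows⁺<c : ∀ {s} → T (isSouth (Y⁺ ! s)) → s < c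
  rows⁺<c {s} south with c ≟ s
  ... | yes refl = ⊥-elim (subst (T ∘ isSouth) (!-insertAt c E Y c≤∣Y∣) south)
  ... | no c≢s with punchOut c≢s | punchIn-punchOut c≢s
  ...   | v | refl = subst (_< c) (sym (punchIn-< v<c)) v<c
    where v<c = rows<c (subst (T ∘ isSouth) (column-letter v) south)

  Box-punchIn : ∀ {s w} → Box Y s w → Box Y⁺ s (punchIn c w)
  Box-punchIn {s} {w} (s<w , south , west) =
    subst (_< punchIn c w) (punchIn-< s<c) (punchIn-mono-< c s<w) ,
    subst (T ∘ isSouth) (sym (row-letter s<c)) south ,
    subst (T ∘ isWest) (sym (column-letter w)) west
    where s<c = rows<c south

  Box-punchIn⁻¹ : ∀ {s w} → Box Y⁺ s (punchIn c w) → Box Y s w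
  Box-punchIn⁻¹ {s} {w} (s<w⁺ , south , west) =
    punchIn-cancel-< c (subst (_< punchIn c w) (sym (punchIn-< s<c)) s<w⁺) ,
    subst (T ∘ isSouth) (row-letter s<c) south ,
    subst (T ∘ isWest) (column-letter w) west
    where s<c = rows⁺<c south

  G-new≢β : ∀ s → G s c ≢ β
  G-new≢β s G≡β with suc s ≟ c
  ... | yes bottom with trans (sym (G-bottom bottom)) G≡β
  ...   | ()
  G-new≢β s G≡β | no above with trans (sym (G-above above)) G≡β
  ...   | ()

  Blocked-punchIn : ∀ {s w} → Blocked Y F s w → Blocked Y⁺ G s (punchIn c w)
  Blocked-punchIn {s} (inj₁ (w' , b , w'<w , e)) =
    inj₁ (punchIn c w' , Box-punchIn b , punchIn-mono-< c w'<w , trans (G-punchIn s w') e)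
  Blocked-punchIn {w = w} (inj₂ (s' , b , s<s' , e)) =
    inj₂ (s' , Box-punchIn b , s<s' , trans (G-punchIn s' w) e)

  Blocked-punchIn⁻¹ : ∀ {s w} → Blocked Y⁺ G s (punchIn c w) → Blocked Y F s w
  Blocked-punchIn⁻¹ {s} (inj₁ (w' , b , w'<w , e)) with c ≟ w'
  ... | yes refl = ⊥-elim (G-new≢β s e)
  ... | no c≢w' with punchOut c≢w' | punchIn-punchOut c≢w'
  ...   | v | refl = inj₁ (v , Box-punchIn⁻¹ b , punchIn-cancel-< c w'<w , trans (sym (G-punchIn s v)) e)
  Blocked-punchIn⁻¹ {w = w} (inj₂ (s' , b , s<s' , e)) =
    inj₂ (s' , Box-punchIn⁻¹ b , s<s' , trans (sym (G-punchIn s' w)) e)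

  ValidBox-punchIn : IsCMCT Y F → ∀ {s w} → Box Y⁺ s (punchIn c w) → ValidBox Y⁺ G s (punchIn c w)
  ValidBox-punchIn h {s} {w} b@(_ , south , _) =
    (λ bl → trans (G-punchIn s w) (proj₁ hY (Blocked-punchIn⁻¹ bl))) ,
    (λ nb → Required-cong (sym (row-letter (rows⁺<c south))) (sym (column-letter w)) (sym (G-punchIn s w))
               (proj₂ hY (nb ∘ Blocked-punchIn)))
    where hY = h s w (Box-punchIn⁻¹ b)

  ValidBox-new : ∀ {s} → Box Y⁺ s c → ValidBox Y⁺ G s c
  ValidBox-new {s} (s<c , south , _) with suc s ≟ c
  ... | yes bottom = (⊥-elim ∘ unblocked) , λ _ →
          subst₂ (Required (Y⁺ ! s)) (sym (!-insertAt c E Y c≤∣Y∣)) (sym (G-bottom bottom)) (Required-α-E south)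
    where
      unblocked : ¬ Blocked Y⁺ G s c
      unblocked (inj₁ (w' , (s<w' , _) , w'<c , _)) = <⇒≱ s<w' (≤-pred (subst (w' <_) (sym bottom) w'<c))
      unblocked (inj₂ (s' , (s'<c , _) , s<s' , _)) = <⇒≱ s<s' (≤-pred (subst (s' <_) (sym bottom) s'<c))
  ... | no above = (λ _ → G-above above) , λ free → ⊥-elim (free α-below)
    where
      r = pred c
      r+1≡c : suc r ≡ c
      r+1≡c = suc-pred c {{≢-nonZero (m<n⇒n≢0 s<c)}}
      r<c : r < c
      r<c = ≤-reflexive r+1≡c
      α-below : Blocked Y⁺ G s c
      α-below = inj₂ (r ,
        (r<c ,
         subst (T ∘ isSouth) (sym (row-letter r<c)) (bottom-row r+1≡c) ,
         subst (T ∘ isWest) (sym (!-insertAt c E Y c≤∣Y∣)) _) ,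
        ≤∧≢⇒< (<⇒≤pred s<c) (λ s≡r → above (trans (cong suc s≡r) r+1≡c)) ,
        G-bottom r+1≡c)

  insertColumn : IsCMCT Y F → IsCMCT Y⁺ G
  insertColumn h s w b with c ≟ w
  ... | yes refl = ValidBox-new b
  ... | no c≢w with punchOut c≢w | punchIn-punchOut c≢w
  ...   | v | refl = ValidBox-punchIn h b

lemma4p6 : (X : List Letter) (F : Filling) →
    IsCMCT (X ∷ʳ D) F → IsCMCT (X ∷ʳ E) (transitionDE X F)
lemma4p6 X F h = subst (λ W → IsCMCT W (transitionDE X F)) (insertAt-cut X) (insertColumn (IsCMCT-∷ʳD X F h))
  where
    open ColumnInsertion X (cut X) F (transitionDE X F)
      (cut≤length X) (isSouth⇒<cut X) (isSouth-pred-cut X)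
      (transitionDE-punchIn X F) (transitionDE-bottom X F) (transitionDE-above X F)
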